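{- Let $k$, $n$, $r$ be positive integers with $n\ge 2r+1$. If the Kneser graph $K(n,r)$ has a $k$-tuple total dominating set (so that $\gamma_{\times k,t}(n,r)$ is defined), then $$\gamma_{\times k,t}(n,r)\ \ge\ \gamma_{\times k,t}(n+1,r).$$
   Context: For integers $n\ge 2r\ge 2$, the Kneser graph $K(n,r)$ has as vertices the $r$-element subsets of $[n]=\{1,\dots,n\}$, two vertices being adjacent iff they are disjoint. For a graph $G$ and a positive integer $k$, a set $D\subseteq V(G)$ is a $k$-tuple total dominating set if $|N_G(u)\cap D|\ge k$ for every vertex $u\in V(G)$, where $N_G(u)$ is the open neighborhood of $u$. The $k$-tuple total domination number $\gamma_{\times k,t}(G)$ is the minimum cardinality of such a set; it is defined only when such a set exists (equivalently, when the minimum degree of $G$ is at least $k$). Write $\gamma_{\times k,t}(n,r)=\gamma_{\times k,t}(K(n,r))$. -}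

module Defs where

open import Data.Nat using (ℕ; _≤_)
open import Data.Bool using (Bool)
import Data.Bool.Properties as BoolP
open import Data.Fin.Subset using (Subset; _∩_; ⊥; ∣_∣)
open import Data.Vec.Properties using (≡-dec)
open import Data.List using (List; length; filter)
open import Data.List.Relation.Unary.All using (All)
open import Data.List.Relation.Unary.Unique.Propositional using (Unique)
open import Data.Product using (Σ; _×_; _,_)
open import Relation.Binary.PropositionalEquality using (_≡_)
open import Relation.Nullary using (Dec)

IsVertex : (n r : ℕ) → Subset n → Set
IsVertex n r s = ∣ s ∣ ≡ r

-- Adjacency in K(n,r): the two subsets are disjoint.
Disjoint : {n : ℕ} → Subset n → Subset n → Set
Disjoint u v = u ∩ v ≡ ⊥

disjoint? : {n : ℕ} (u v : Subset n) → Dec (Disjoint u v)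
disjoint? u v = ≡-dec BoolP._≟_ (u ∩ v) ⊥

IsVertexSet : (n r : ℕ) → List (Subset n) → Set
IsVertexSet n r D = Unique D × All (IsVertex n r) D

-- |N(u) ∩ D| : the number of elements of D adjacent to (disjoint from) u.
-- (A set is never disjoint-adjacent to itself when r ≥ 1, so this is the open neighbourhood.)
nbrCount : {n : ℕ} → Subset n → List (Subset n) → ℕ
nbrCount u D = length (filter (disjoint? u) D)

IsKTupleTDS : (n r k : ℕ) → List (Subset n) → Set
IsKTupleTDS n r k D =
  IsVertexSet n r D × ((u : Subset n) → IsVertex n r u → k ≤ nbrCount u D)

IsKTupleTDNumber : (n r k m : ℕ) → Set
IsKTupleTDNumber n r k m =
  Σ (List (Subset n)) (λ D → IsKTupleTDS n r k D × length D ≡ m)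
  × ((D : List (Subset n)) → IsKTupleTDS n r k D → m ≤ length D)

HasKTupleTDS : (n r k : ℕ) → Set
HasKTupleTDS n r k = Σ (List (Subset n)) (IsKTupleTDS n r k)

-- A k-tuple total dominating set D of K(n,r) remains one in K(n+1,r) once its members are read as
-- subsets of [n+1] avoiding the new point. The only new vertices u contain the new point; the rest
-- of u lies inside some r-subset v of [n], and every member of D disjoint from v is disjoint from u,
-- so u has at least as many neighbours in D as v does. Hence a minimum set for K(n,r) dominates
-- K(n+1,r), and the minimum there is no larger. Both minima exist because only finitely many
-- families of subsets have a given size, so the least size of a dominating family can be searched for.
module Submission where

open import Defs
open import Data.Nat using (ℕ; suc; _+_; _*_; _≤_; _≥_)
open import Data.Product using (Σ; _×_)

open import Data.Bool using (true; false)
import Data.Bool.Properties as Bool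
open import Data.Empty using (⊥-elim)
open import Data.Fin.Subset as Subset using (Subset; outside; inside; _⊆_; ∣_∣)
open import Data.Fin.Subset.Properties using (⊆-refl; out⊆; in⊆in; Empty-unique; ∉⊥; x∈p∩q⁺; x∈p∩q⁻)
open import Data.List using (List; []; _∷_; length; filter; map; cartesianProductWith)
open import Data.List.Properties using (length-map)
open import Data.List.Membership.Propositional using (_∈_; lose)
open import Data.List.Membership.Propositional.Properties using (∈-cartesianProductWith⁺)
open import Data.List.Relation.Unary.All using (all?)
import Data.List.Relation.Unary.All as All
import Data.List.Relation.Unary.All.Properties as All
open import Data.List.Relation.Unary.Any using (Any; here; there; any?; satisfied)
import Data.List.Relation.Unary.Unique.Propositional.Properties as Unique
open import Data.List.Relation.Unary.Unique.DecPropositional using (unique?)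
open import Data.Nat using (zero; _<_; _≟_; _≤?_; z≤n; s≤s)
open import Data.Nat.Properties using (≤-refl; ≤-reflexive; ≤-trans; ≮⇒≥; m≤m+n; m<1+n⇒m<n∨m≡n; m≤n⇒m≤1+n)
open import Data.Product using (_,_; ∃-syntax)
open import Data.Sum using (_⊎_; inj₁; inj₂)
open import Data.Vec using (Vec; []; _∷_; tail; toList; fromList)
open import Data.Vec.Properties using (≡-dec; ∷-injectiveʳ; length-toList; toList∘fromList)
open import Relation.Binary.PropositionalEquality using (_≡_; refl; sym; trans; subst; cong; cong₂)
open import Relation.Nullary using (Dec; yes; no; ¬_)
open import Relation.Nullary.Decidable using (_×-dec_; _→-dec_)
open import Relation.Unary using (Decidable)

Least : (ℕ → Set) → Set
Least Q = Σ ℕ (λ m → Q m × (∀ j → Q j → m ≤ j))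

module _ {Q : ℕ → Set} (Q? : Decidable Q) where

  least-below : ∀ n → (∀ j → j < n → ¬ Q j) ⊎ Least Q
  least-below zero = inj₁ (λ _ ())
  least-below (suc n) with least-below n | Q? n
  ... | inj₂ least   | _      = inj₂ least
  ... | inj₁ none<n  | yes qn = inj₂ (n , qn , λ j qj → ≮⇒≥ (λ j<n → none<n j j<n qj))
  ... | inj₁ none<n  | no ¬qn = inj₁ none≤n
    where
    none≤n : ∀ j → j < suc n → ¬ Q j
    none≤n j j<1+n with m<1+n⇒m<n∨m≡n j<1+n
    ... | inj₁ j<n  = none<n j j<n
    ... | inj₂ refl = ¬qn

  least-witness : ∀ {n} → Q n → Least Q
  least-witness {n} qn with least-below (suc n)
  ... | inj₁ none = ⊥-elim (none n ≤-refl qn)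
  ... | inj₂ least = least

vectors : {A : Set} → List A → (n : ℕ) → List (Vec A n)
vectors xs zero    = [] ∷ []
vectors xs (suc n) = cartesianProductWith _∷_ xs (vectors xs n)

∈-vectors : {A : Set} {xs : List A} → (∀ x → x ∈ xs) → ∀ {n} (v : Vec A n) → v ∈ vectors xs n
∈-vectors xs-complete []      = here refl
∈-vectors xs-complete (x ∷ v) = ∈-cartesianProductWith⁺ _∷_ (xs-complete x) (∈-vectors xs-complete v)

module _ {A : Set} {U : List A} (U-complete : ∀ x → x ∈ U)
         {P : List A → Set} (P? : Decidable P) where

  private
    HasWitnessOfLength : ℕ → Set
    HasWitnessOfLength m = Σ (List A) (λ xs → P xs × length xs ≡ m)

    EnumeratedWitness : ℕ → Set
    EnumeratedWitness m = Any (λ v → P (toList v)) (vectors U m)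

    enumerated? : Decidable EnumeratedWitness
    enumerated? m = any? (λ v → P? (toList v)) (vectors U m)

    enumerate : ∀ {xs} → P xs → EnumeratedWitness (length xs)
    enumerate {xs} pxs =
      lose (∈-vectors U-complete (fromList xs)) (subst P (sym (toList∘fromList xs)) pxs)

    unenumerate : ∀ {m} → EnumeratedWitness m → HasWitnessOfLength m
    unenumerate w with satisfied w
    ... | v , pv = toList v , pv , length-toList v

  shortest-witness : Σ (List A) P →
    Σ ℕ (λ m → HasWitnessOfLength m × (∀ xs → P xs → m ≤ length xs))
  shortest-witness (xs , pxs) with least-witness enumerated? (enumerate pxs)
  ... | m , wm , minimal = m , unenumerate wm , λ ys pys → minimal (length ys) (enumerate pys)

subsets : (n : ℕ) → List (Subset n)
subsets = vectors (true ∷ false ∷ [])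

∈-subsets : ∀ {n} (p : Subset n) → p ∈ subsets n
∈-subsets = ∈-vectors λ { true → here refl ; false → there (here refl) }

isKTupleTDS? : (n r k : ℕ) → Decidable (IsKTupleTDS n r k)
isKTupleTDS? n r k D =
  (unique? (≡-dec Bool._≟_) D ×-dec all? (λ s → ∣ s ∣ ≟ r) D) ×-dec dominates?
  where
  dominates? : Dec ((u : Subset n) → IsVertex n r u → k ≤ nbrCount u D)
  dominates? with all? (λ u → (∣ u ∣ ≟ r) →-dec (k ≤? nbrCount u D)) (subsets n)
  ... | yes all-u = yes λ u → All.lookup all-u (∈-subsets u)
  ... | no ¬all-u = no λ dom → ¬all-u (All.tabulate λ {u} _ → dom u)

kTupleTDNumber : (n r k : ℕ) → HasKTupleTDS n r k → Σ ℕ (IsKTupleTDNumber n r k)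
kTupleTDNumber n r k = shortest-witness ∈-subsets (isKTupleTDS? n r k)

Disjoint-antimonoˡ : ∀ {n} {u v s : Subset n} → u ⊆ v → Disjoint v s → Disjoint u s
Disjoint-antimonoˡ {u = u} {s = s} u⊆v v∩s≡⊥ = Empty-unique λ (x , x∈u∩s) →
  let x∈u , x∈s = x∈p∩q⁻ u s x∈u∩s
  in ∉⊥ (subst (x Subset.∈_) v∩s≡⊥ (x∈p∩q⁺ (u⊆v x∈u , x∈s)))

Disjoint-outside : ∀ {n} b {u s : Subset n} → Disjoint u s → Disjoint (b ∷ u) (outside ∷ s)
Disjoint-outside b u∩s≡⊥ = cong₂ _∷_ (Bool.∧-zeroʳ b) u∩s≡⊥

extend-by-one : ∀ {n} (p : Subset n) → ∣ p ∣ < n → ∃[ q ] p ⊆ q × ∣ q ∣ ≡ suc ∣ p ∣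
extend-by-one (false ∷ p) _ = inside ∷ p , out⊆ ⊆-refl , refl
extend-by-one (true ∷ p) (s≤s ∣p∣<n) with extend-by-one p ∣p∣<n
... | q , p⊆q , ∣q∣≡1+∣p∣ = inside ∷ q , in⊆in p⊆q , cong suc ∣q∣≡1+∣p∣

tail-⊆-vertex : ∀ {n r} → r ≤ n → (u : Subset (suc n)) → IsVertex (suc n) r u →
  ∃[ v ] IsVertex n r v × tail u ⊆ v
tail-⊆-vertex r≤n (false ∷ u) ∣u∣≡r = u , ∣u∣≡r , ⊆-refl
tail-⊆-vertex r≤n (true ∷ u) refl with extend-by-one u r≤n
... | v , u⊆v , ∣v∣≡r = v , ∣v∣≡r , u⊆v

length-filter-map-≤ : {A B : Set} {P : A → Set} {Q : B → Set} (P? : Decidable P) (Q? : Decidable Q)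
  (f : A → B) → (∀ {x} → P x → Q (f x)) →
  ∀ xs → length (filter P? xs) ≤ length (filter Q? (map f xs))
length-filter-map-≤ P? Q? f P⇒Q [] = z≤n
length-filter-map-≤ P? Q? f P⇒Q (x ∷ xs) with P? x | Q? (f x)
... | yes _  | yes _  = s≤s (length-filter-map-≤ P? Q? f P⇒Q xs)
... | no _   | yes _  = m≤n⇒m≤1+n (length-filter-map-≤ P? Q? f P⇒Q xs)
... | no _   | no _   = length-filter-map-≤ P? Q? f P⇒Q xs
... | yes px | no ¬qx = ⊥-elim (¬qx (P⇒Q px))

lift-KTupleTDS : ∀ {n r k D} → r ≤ n → IsKTupleTDS n r k D →
  IsKTupleTDS (suc n) r k (map (outside ∷_) D)
lift-KTupleTDS {n} {r} {k} {D} r≤n ((unique-D , vertices-D) , dominates) =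
  (Unique.map⁺ ∷-injectiveʳ unique-D , All.map⁺ vertices-D) , dominates′
  where
  dominates′ : (u : Subset (suc n)) → IsVertex (suc n) r u → k ≤ nbrCount u (map (outside ∷_) D)
  dominates′ (b ∷ u) vertex-u with tail-⊆-vertex r≤n (b ∷ u) vertex-u
  ... | v , vertex-v , u⊆v = ≤-trans (dominates v vertex-v)
        (length-filter-map-≤ (disjoint? v) (disjoint? (b ∷ u)) (outside ∷_)
          (λ v∩s≡⊥ → Disjoint-outside b (Disjoint-antimonoˡ u⊆v v∩s≡⊥)) D)

kTupleTDNumber-suc-≤ : ∀ {n r k} → r ≤ n → HasKTupleTDS n r k →
  Σ ℕ (λ g → IsKTupleTDNumber n r k g ×
  Σ ℕ (λ g' → IsKTupleTDNumber (suc n) r k g' × g' ≤ g))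
kTupleTDNumber-suc-≤ {n} {r} {k} r≤n has-TDS with kTupleTDNumber n r k has-TDS
... | g , γ@((D , D-TDS , ∣D∣≡g) , _)
  with kTupleTDNumber (suc n) r k (map (outside ∷_) D , lift-KTupleTDS r≤n D-TDS)
... | g' , γ'@(_ , minimal') =
  g , γ , g' , γ' , ≤-trans (minimal' _ (lift-KTupleTDS r≤n D-TDS))
                            (≤-reflexive (trans (length-map (outside ∷_) D) ∣D∣≡g))

mainTheorem1 : (k n r : ℕ) → 1 ≤ k → 1 ≤ r → n ≥ 2 * r + 1 →
    HasKTupleTDS n r k →
    Σ ℕ (λ g → IsKTupleTDNumber n r k g ×
    Σ ℕ (λ g' → IsKTupleTDNumber (suc n) r k g' × g' ≤ g))
mainTheorem1 k n r _ _ n≥2r+1 =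
  kTupleTDNumber-suc-≤ (≤-trans (m≤m+n r (r + 0)) (≤-trans (m≤m+n (2 * r) 1) n≥2r+1))
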